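{- Let $\mathcal{W}=\mathrm{Av}(132,312)\cup\mathrm{Av}(213,231)\cup\mathrm{Av}(132,231)\cup\mathrm{Av}(213,312)$ and $\mathcal{A}=\mathcal{W}\cup\{2143,2413,3142,3412,25314,41352\}$, and let $\mathcal{A}_n$ be the set of permutations of length $n$ in $\mathcal{A}$. Then $|\mathcal{A}_n| = 2^{n+1}-4n+2$ for all $n\ge 6$.
   Context: Permutations are partially ordered by pattern containment; $\mathrm{Av}(B)$ denotes the set of permutations containing no element of $B$ as a pattern. -}

module Defs where

open import Data.Nat using (ℕ; zero; suc; _<_; _+_; _*_; _^_)
open import Data.List using (List; []; _∷_; length; map; upTo)
open import Data.List.Membership.Propositional using (_∈_)
open import Data.List.Relation.Binary.Sublist.Propositional using (_⊆_)
open import Data.List.Relation.Binary.Permutation.Propositional using (_↭_)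
open import Data.List.Relation.Unary.Unique.Propositional using (Unique)
open import Data.Product using (_×_; ∃-syntax)
open import Data.Sum using (_⊎_)
open import Function.Bundles using (_⇔_)
open import Relation.Nullary using (¬_)
open import Relation.Binary.PropositionalEquality using (_≡_)

-- A permutation of length n is written in one-line notation as a list of
-- naturals that is a rearrangement of 1, 2, ..., n.
IsPerm : ℕ → List ℕ → Set
IsPerm n σ = σ ↭ map suc (upTo n)

-- i-th entry (0-based) of a list; default 0 out of range (never used there).
at : List ℕ → ℕ → ℕ
at []       _       = 0
at (x ∷ xs) zero    = x
at (x ∷ xs) (suc i) = at xs i

OrderIso : List ℕ → List ℕ → Set
OrderIso τ π = length τ ≡ length π ×
  (∀ i j → i < length π → j < length π → (at τ i < at τ j ⇔ at π i < at π j))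

Contains : List ℕ → List ℕ → Set
Contains σ π = ∃[ τ ] (τ ⊆ σ × OrderIso τ π)

Av : List (List ℕ) → List ℕ → Set
Av B σ = ∀ π → π ∈ B → ¬ Contains σ π

p132 p312 p213 p231 : List ℕ
p132 = 1 ∷ 3 ∷ 2 ∷ []
p312 = 3 ∷ 1 ∷ 2 ∷ []
p213 = 2 ∷ 1 ∷ 3 ∷ []
p231 = 2 ∷ 3 ∷ 1 ∷ []

InW : List ℕ → Set
InW σ = Av (p132 ∷ p312 ∷ []) σ ⊎ Av (p213 ∷ p231 ∷ []) σ
      ⊎ Av (p132 ∷ p231 ∷ []) σ ⊎ Av (p213 ∷ p312 ∷ []) σ

extra : List (List ℕ)
extra = (2 ∷ 1 ∷ 4 ∷ 3 ∷ []) ∷ (2 ∷ 4 ∷ 1 ∷ 3 ∷ []) ∷ (3 ∷ 1 ∷ 4 ∷ 2 ∷ [])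
      ∷ (3 ∷ 4 ∷ 1 ∷ 2 ∷ []) ∷ (2 ∷ 5 ∷ 3 ∷ 1 ∷ 4 ∷ []) ∷ (4 ∷ 1 ∷ 3 ∷ 5 ∷ 2 ∷ []) ∷ []

InA : List ℕ → Set
InA σ = InW σ ⊎ σ ∈ extra

CardA : ℕ → ℕ → Set
CardA n k = ∃[ L ] (Unique L × length L ≡ k × (∀ σ → σ ∈ L ⇔ (IsPerm n σ × InA σ)))

module Submission where

-- Each class in 𝒲 is generated by a sequence of binary choices, so its permutations of
-- length m + 1 are encoded bijectively by bit strings of length m: in Av(213,231) every entry
-- is the smallest or the largest of the entries from it onwards (peelLeft), Av(132,312)
-- consists of the reversals of these (peelRight), and in Av(132,231), resp. Av(213,312), the
-- largest, resp. smallest, entry sits at one end (valley, mountain).  Whether an encoded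
-- permutation contains a pattern of another class only depends on whether its bit string has
-- a true before a false or a false before a true.  Hence 𝒲 of length n = m + 1 is the
-- disjoint union of all 2^m encodings in Av(213,231), the 2^m - 2 non-constant ones in
-- Av(132,312), and twice the 2^m - 2m strings having both a true before a false and a false
-- before a true (encoded in Av(132,231) and in Av(213,312)), which totals 2^(n+1) - 4n + 2.
-- The six extra permutations are too short to matter once n ≥ 6.

open import Defs
open import Data.Bool using (Bool; true; false; T; not; _∨_; _∧_)
open import Data.Bool.Properties using (∨-zeroʳ; ∧-identityʳ; T-∨; T-∧)
open import Data.Empty using (⊥; ⊥-elim)
open import Data.List using (List; []; _∷_; _++_; _∷ʳ_; length; map; reverse; upTo; applyUpTo; filterᵇ)
open import Data.List.Properties
  using ( ∷-injectiveˡ; ∷-injectiveʳ; ∷ʳ-injective; ∷ʳ-injectiveˡ; reverse-involutive; reverse-injective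
        ; ++-identityʳ; length-map; length-++; map-applyUpTo; filter-++; filter-≐; filter-none)
open import Data.List.Membership.Propositional using (_∈_; _∉_)
open import Data.List.Membership.Propositional.Properties
  using (∈-++⁺ˡ; ∈-++⁺ʳ; ∈-++⁻; ∈-map⁺; ∈-map⁻; ∈-∃++; ∈-filter⁺; ∈-map∘filter⁻)
open import Data.List.Relation.Binary.Disjoint.Propositional using (Disjoint)
open import Data.List.Relation.Binary.Permutation.Propositional
  using (_↭_; ↭-refl; ↭-sym; ↭-trans; prep; ↭⇒↭ₛ)
open import Data.List.Relation.Binary.Permutation.Propositional.Properties
  using (∈-resp-↭; ∷↭∷ʳ; ↭-reverse; ↭-length; ↭-singleton-inv; drop-∷; shift)
import Data.List.Relation.Binary.Permutation.Setoid.Properties as Setoid↭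
open import Data.List.Relation.Binary.Sublist.Propositional
  using (_⊆_; []; _∷_; ⊆-refl; ⊆-trans; minimum; from∈; lookup)
  renaming (_∷ʳ_ to skip)
open import Data.List.Relation.Binary.Sublist.Propositional.Properties using (++⁺; ++⁺ˡ; ++⁺ʳ; reverse⁺)
open import Data.List.Relation.Unary.All as All using (All)
import Data.List.Relation.Unary.All.Properties as All
open import Data.List.Relation.Unary.Any using (here; there)
open import Data.List.Relation.Unary.Unique.Propositional using (Unique; []; _∷_)
import Data.List.Relation.Unary.Unique.Propositional.Properties as Unique
open import Data.Nat using (ℕ; zero; suc; _≟_; _≤?_; _≤_; _<_; _>_; _+_; _*_; _^_; _∸_; s≤s; z<s; s<s)
open import Data.Nat.Properties
open import Data.Nat.Tactic.RingSolver using (solve-∀)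
open import Data.Product using (_×_; _,_; ∃-syntax; proj₁; proj₂; swap)
open import Data.Sum using (_⊎_; inj₁; inj₂)
open import Data.Sum.Function.Propositional using (_⊎-⇔_)
open import Data.Unit using (tt)
open import Function.Base using (_∘_; id; case_of_)
open import Function.Bundles using (_⇔_; mk⇔; Equivalence)
open import Function.Construct.Composition using (_⇔-∘_)
open import Function.Related.TypeIsomorphisms using (¬-cong-⇔)
open import Relation.Binary.Definitions using (Tri; tri<; tri≈; tri>)
open import Relation.Binary.PropositionalEquality
  using (_≡_; _≢_; refl; sym; trans; cong; cong₂; subst; setoid; module ≡-Reasoning)
open import Relation.Nullary using (¬_; yes; no)
open import Relation.Nullary.Decidable using (T?; from-yes)

-- Patterns of length three

Rel₃ : Set₁
Rel₃ = ℕ → ℕ → ℕ → Set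

Occurs₂ : (ℕ → ℕ → Set) → List ℕ → Set
Occurs₂ R σ = ∃[ a ] ∃[ b ] (a ∷ b ∷ []) ⊆ σ × R a b

Occurs₃ : Rel₃ → List ℕ → Set
Occurs₃ R σ = ∃[ a ] ∃[ b ] ∃[ c ] (a ∷ b ∷ c ∷ []) ⊆ σ × R a b c

Is132 Is312 Is213 Is231 : Rel₃
Is132 a b c = a < c × c < b
Is312 a b c = b < c × c < a
Is213 a b c = b < a × a < c
Is231 a b c = c < a × a < b

SameOrder : ℕ → ℕ → ℕ → ℕ → Set
SameOrder x y u v = (x < y ⇔ u < v) × (y < x ⇔ v < u)

same-order : ∀ {x y u v} → x < y → u < v → SameOrder x y u v
same-order x<y u<v =
  mk⇔ (λ _ → u<v) (λ _ → x<y) ,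
  mk⇔ (λ y<x → ⊥-elim (<-asym x<y y<x)) (λ v<u → ⊥-elim (<-asym u<v v<u))

order-iso₃⇔ : ∀ {a b c p q r} → OrderIso (a ∷ b ∷ c ∷ []) (p ∷ q ∷ r ∷ []) ⇔
              (SameOrder a b p q × SameOrder a c p r × SameOrder b c q r)
order-iso₃⇔ {a} {b} {c} {p} {q} {r} = mk⇔ to from
  where
  to : OrderIso (a ∷ b ∷ c ∷ []) (p ∷ q ∷ r ∷ []) →
       SameOrder a b p q × SameOrder a c p r × SameOrder b c q r
  to (_ , iso) = (iso 0 1 z<s 1<3 , iso 1 0 1<3 z<s) ,
                 (iso 0 2 z<s 2<3 , iso 2 0 2<3 z<s) ,
                 (iso 1 2 1<3 2<3 , iso 2 1 2<3 1<3)
    where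
    1<3 : 1 < 3
    1<3 = s<s z<s
    2<3 : 2 < 3
    2<3 = s<s (s<s z<s)
  from : SameOrder a b p q × SameOrder a c p r × SameOrder b c q r →
         OrderIso (a ∷ b ∷ c ∷ []) (p ∷ q ∷ r ∷ [])
  from (ab , ac , bc) = refl , iso
    where
    irreflexive : ∀ {x y} → x < x ⇔ y < y
    irreflexive = mk⇔ (λ x<x → ⊥-elim (<-irrefl refl x<x)) (λ y<y → ⊥-elim (<-irrefl refl y<y))
    iso : ∀ i j → i < 3 → j < 3 →
          (at (a ∷ b ∷ c ∷ []) i < at (a ∷ b ∷ c ∷ []) j ⇔ at (p ∷ q ∷ r ∷ []) i < at (p ∷ q ∷ r ∷ []) j)
    iso 0 0 _ _ = irreflexive
    iso 0 1 _ _ = proj₁ ab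
    iso 0 2 _ _ = proj₁ ac
    iso 1 0 _ _ = proj₂ ab
    iso 1 1 _ _ = irreflexive
    iso 1 2 _ _ = proj₁ bc
    iso 2 0 _ _ = proj₂ ac
    iso 2 1 _ _ = proj₂ bc
    iso 2 2 _ _ = irreflexive
    iso (suc (suc (suc _))) _ (s≤s (s≤s (s≤s ()))) _
    iso _ (suc (suc (suc _))) _ (s≤s (s≤s (s≤s ())))

contains₃⇔ : ∀ {σ p q r} → Contains σ (p ∷ q ∷ r ∷ []) ⇔
  (∃[ a ] ∃[ b ] ∃[ c ] (a ∷ b ∷ c ∷ []) ⊆ σ × SameOrder a b p q × SameOrder a c p r × SameOrder b c q r)
contains₃⇔ = mk⇔ (λ { ((a ∷ b ∷ c ∷ []) , s , iso) → a , b , c , s , Equivalence.to order-iso₃⇔ iso })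
                 (λ { (a , b , c , s , orders) → _ , s , Equivalence.from order-iso₃⇔ orders })

ordered : ∀ {x y u v} → SameOrder x y u v → u < v → x < y
ordered = Equivalence.from ∘ proj₁

reversed : ∀ {x y u v} → SameOrder x y u v → v < u → y < x
reversed = Equivalence.from ∘ proj₂

contains-132⇔ : ∀ {σ} → Contains σ p132 ⇔ Occurs₃ Is132 σ
contains-132⇔ = mk⇔
  (λ C → let a , b , c , s , _ , ac , bc = Equivalence.to contains₃⇔ C
         in a , b , c , s , ordered ac (s<s z<s) , reversed bc (s<s (s<s z<s)))
  (λ { (a , b , c , s , a<c , c<b) → Equivalence.from contains₃⇔
         (a , b , c , s , same-order (<-trans a<c c<b) (s<s z<s) , same-order a<c (s<s z<s) ,
          swap (same-order c<b (s<s (s<s z<s)))) })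

contains-312⇔ : ∀ {σ} → Contains σ p312 ⇔ Occurs₃ Is312 σ
contains-312⇔ = mk⇔
  (λ C → let a , b , c , s , _ , ac , bc = Equivalence.to contains₃⇔ C
         in a , b , c , s , ordered bc (s<s z<s) , reversed ac (s<s (s<s z<s)))
  (λ { (a , b , c , s , b<c , c<a) → Equivalence.from contains₃⇔
         (a , b , c , s , swap (same-order (<-trans b<c c<a) (s<s z<s)) ,
          swap (same-order c<a (s<s (s<s z<s))) , same-order b<c (s<s z<s)) })

contains-213⇔ : ∀ {σ} → Contains σ p213 ⇔ Occurs₃ Is213 σ
contains-213⇔ = mk⇔
  (λ C → let a , b , c , s , ab , ac , _ = Equivalence.to contains₃⇔ C
         in a , b , c , s , reversed ab (s<s z<s) , ordered ac (s<s (s<s z<s)))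
  (λ { (a , b , c , s , b<a , a<c) → Equivalence.from contains₃⇔
         (a , b , c , s , swap (same-order b<a (s<s z<s)) , same-order a<c (s<s (s<s z<s)) ,
          same-order (<-trans b<a a<c) (s<s z<s)) })

contains-231⇔ : ∀ {σ} → Contains σ p231 ⇔ Occurs₃ Is231 σ
contains-231⇔ = mk⇔
  (λ C → let a , b , c , s , ab , ac , _ = Equivalence.to contains₃⇔ C
         in a , b , c , s , reversed ac (s<s z<s) , ordered ab (s<s (s<s z<s)))
  (λ { (a , b , c , s , c<a , a<b) → Equivalence.from contains₃⇔
         (a , b , c , s , same-order a<b (s<s (s<s z<s)) , swap (same-order c<a (s<s z<s)) ,
          swap (same-order (<-trans c<a a<b) (s<s z<s))) })

Avoids : Rel₃ → Rel₃ → List ℕ → Set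
Avoids R S σ = ¬ Occurs₃ R σ × ¬ Occurs₃ S σ

Av-pair⇔ : ∀ {p q R S σ} → Contains σ p ⇔ Occurs₃ R σ → Contains σ q ⇔ Occurs₃ S σ →
           Av (p ∷ q ∷ []) σ ⇔ Avoids R S σ
Av-pair⇔ p⇔R q⇔S = mk⇔
  (λ av → Equivalence.to (¬-cong-⇔ p⇔R) (av _ (here refl)) ,
          Equivalence.to (¬-cong-⇔ q⇔S) (av _ (there (here refl))))
  (λ { (¬R , ¬S) _ (here refl) → Equivalence.from (¬-cong-⇔ p⇔R) ¬R
     ; (¬R , ¬S) _ (there (here refl)) → Equivalence.from (¬-cong-⇔ q⇔S) ¬S })

𝒲₁ 𝒲₂ 𝒲₃ 𝒲₄ : List ℕ → Set
𝒲₁ = Avoids Is132 Is312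
𝒲₂ = Avoids Is213 Is231
𝒲₃ = Avoids Is132 Is231
𝒲₄ = Avoids Is213 Is312

𝒲 : List ℕ → Set
𝒲 σ = 𝒲₁ σ ⊎ 𝒲₂ σ ⊎ 𝒲₃ σ ⊎ 𝒲₄ σ

InW⇔ : ∀ {σ} → InW σ ⇔ 𝒲 σ
InW⇔ = Av-pair⇔ contains-132⇔ contains-312⇔ ⊎-⇔ Av-pair⇔ contains-213⇔ contains-231⇔
    ⊎-⇔ Av-pair⇔ contains-132⇔ contains-231⇔ ⊎-⇔ Av-pair⇔ contains-213⇔ contains-312⇔

first∈ : ∀ {x y : ℕ} {σ} → (x ∷ y ∷ []) ⊆ σ → x ∈ σ
first∈ s = lookup s (here refl)

second∈ : ∀ {x y : ℕ} {σ} → (x ∷ y ∷ []) ⊆ σ → y ∈ σ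
second∈ s = lookup s (there (here refl))

Occurs₂-⊆ : ∀ {R xs ys} → xs ⊆ ys → Occurs₂ R xs → Occurs₂ R ys
Occurs₂-⊆ xs⊆ys (a , b , s , r) = a , b , ⊆-trans s xs⊆ys , r

Occurs₃-⊆ : ∀ {R xs ys} → xs ⊆ ys → Occurs₃ R xs → Occurs₃ R ys
Occurs₃-⊆ xs⊆ys (a , b , c , s , r) = a , b , c , ⊆-trans s xs⊆ys , r

Avoids-⊆ : ∀ {R S xs ys} → xs ⊆ ys → Avoids R S ys → Avoids R S xs
Avoids-⊆ xs⊆ys (¬R , ¬S) = ¬R ∘ Occurs₃-⊆ xs⊆ys , ¬S ∘ Occurs₃-⊆ xs⊆ys

¬Occurs₂-[x] : ∀ {R x} → ¬ Occurs₂ R (x ∷ [])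
¬Occurs₂-[x] (_ , _ , skip _ () , _)
¬Occurs₂-[x] (_ , _ , _ ∷ () , _)

¬Occurs₃-[x] : ∀ {R x} → ¬ Occurs₃ R (x ∷ [])
¬Occurs₃-[x] (_ , _ , _ , skip _ () , _)
¬Occurs₃-[x] (_ , _ , _ , _ ∷ () , _)

Occurs₂-∷⁺ : ∀ {R x y σ} → y ∈ σ → R x y → Occurs₂ R (x ∷ σ)
Occurs₂-∷⁺ y∈σ r = _ , _ , refl ∷ from∈ y∈σ , r

Occurs₂-∷⁻ : ∀ {R x σ} → Occurs₂ R (x ∷ σ) → Occurs₂ R σ ⊎ ∃[ y ] y ∈ σ × R x y
Occurs₂-∷⁻ (a , b , skip _ s , r) = inj₁ (a , b , s , r)
Occurs₂-∷⁻ (a , b , refl ∷ s , r) = inj₂ (b , lookup s (here refl) , r)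

Occurs₃-∷⁺ : ∀ {R x σ} → Occurs₂ (R x) σ → Occurs₃ R (x ∷ σ)
Occurs₃-∷⁺ (b , c , s , r) = _ , b , c , refl ∷ s , r

Occurs₃-∷⁻ : ∀ {R x σ} → Occurs₃ R (x ∷ σ) → Occurs₃ R σ ⊎ Occurs₂ (R x) σ
Occurs₃-∷⁻ (a , b , c , skip _ s , r) = inj₁ (a , b , c , s , r)
Occurs₃-∷⁻ (a , b , c , refl ∷ s , r) = inj₂ (b , c , s , r)

⊆-∷ʳ⁻ : ∀ {ys : List ℕ} σ x → ys ⊆ σ ∷ʳ x → ys ⊆ σ ⊎ ∃[ zs ] ys ≡ zs ∷ʳ x × zs ⊆ σ
⊆-∷ʳ⁻ []      x (skip _ []) = inj₁ []
⊆-∷ʳ⁻ []      x (refl ∷ []) = inj₂ ([] , refl , [])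
⊆-∷ʳ⁻ (y ∷ σ) x (skip _ s) with ⊆-∷ʳ⁻ σ x s
... | inj₁ s′             = inj₁ (skip y s′)
... | inj₂ (zs , eq , s′) = inj₂ (zs , eq , skip y s′)
⊆-∷ʳ⁻ (y ∷ σ) x (refl ∷ s) with ⊆-∷ʳ⁻ σ x s
... | inj₁ s′               = inj₁ (refl ∷ s′)
... | inj₂ (zs , refl , s′) = inj₂ (y ∷ zs , refl , refl ∷ s′)

Occurs₂-∷ʳ⁺ : ∀ {R x y σ} → y ∈ σ → R y x → Occurs₂ R (σ ∷ʳ x)
Occurs₂-∷ʳ⁺ y∈σ r = _ , _ , ++⁺ (from∈ y∈σ) ⊆-refl , r

Occurs₂-∷ʳ⁻ : ∀ {R x} σ → Occurs₂ R (σ ∷ʳ x) → Occurs₂ R σ ⊎ ∃[ y ] y ∈ σ × R y x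
Occurs₂-∷ʳ⁻ {x = x} σ (a , b , s , r) with ⊆-∷ʳ⁻ σ x s
... | inj₁ s′ = inj₁ (a , b , s′ , r)
... | inj₂ (zs , eq , s′) with refl , refl ← ∷ʳ-injective (a ∷ []) zs eq =
  inj₂ (a , lookup s′ (here refl) , r)

Occurs₃-∷ʳ⁺ : ∀ {R x σ} → Occurs₂ (λ a b → R a b x) σ → Occurs₃ R (σ ∷ʳ x)
Occurs₃-∷ʳ⁺ (a , b , s , r) = a , b , _ , ++⁺ s ⊆-refl , r

Occurs₃-∷ʳ⁻ : ∀ {R x} σ → Occurs₃ R (σ ∷ʳ x) → Occurs₃ R σ ⊎ Occurs₂ (λ a b → R a b x) σ
Occurs₃-∷ʳ⁻ {x = x} σ (a , b , c , s , r) with ⊆-∷ʳ⁻ σ x s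
... | inj₁ s′ = inj₁ (a , b , c , s′ , r)
... | inj₂ (zs , eq , s′) with refl , refl ← ∷ʳ-injective (a ∷ b ∷ []) zs eq =
  inj₂ (a , b , s′ , r)

_˘ : Rel₃ → Rel₃
(R ˘) a b c = R c b a

Occurs₃-reverse⇔ : ∀ {R} σ → Occurs₃ R (reverse σ) ⇔ Occurs₃ (R ˘) σ
Occurs₃-reverse⇔ σ = mk⇔
  (λ (a , b , c , s , r) → c , b , a , subst (_ ⊆_) (reverse-involutive σ) (reverse⁺ s) , r)
  (λ (a , b , c , s , r) → c , b , a , reverse⁺ s , r)

-- Permutations of an interval

range : ℕ → ℕ → List ℕ
range lo zero    = []
range lo (suc k) = lo ∷ range (suc lo) k

range-∷ʳ : ∀ lo k → range lo (suc k) ≡ range lo k ∷ʳ (lo + k)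
range-∷ʳ lo zero    = cong (λ x → x ∷ []) (sym (+-identityʳ lo))
range-∷ʳ lo (suc k) =
  cong (lo ∷_) (trans (range-∷ʳ (suc lo) k) (cong (range (suc lo) k ∷ʳ_) (sym (+-suc lo k))))

∈-range⁻ : ∀ {v} lo k → v ∈ range lo k → lo ≤ v × v < lo + k
∈-range⁻ lo (suc k) (here refl) = ≤-refl , m<m+n lo z<s
∈-range⁻ {v} lo (suc k) (there v∈) =
  let lo<v , v<hi = ∈-range⁻ (suc lo) k v∈ in <⇒≤ lo<v , subst (v <_) (sym (+-suc lo k)) v<hi

max∈range : ∀ lo k → lo + k ∈ range lo (suc k)
max∈range lo k = subst (lo + k ∈_) (sym (range-∷ʳ lo k)) (∈-++⁺ʳ (range lo k) (here refl))

length-range : ∀ lo k → length (range lo k) ≡ k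
length-range lo zero    = refl
length-range lo (suc k) = cong suc (length-range (suc lo) k)

Unique-range : ∀ lo k → Unique (range lo k)
Unique-range lo zero    = []
Unique-range lo (suc k) =
  All.tabulate (λ v∈ lo≡v → <-irrefl lo≡v (proj₁ (∈-range⁻ (suc lo) k v∈))) ∷ Unique-range (suc lo) k

applyUpTo≡range : ∀ (f : ℕ → ℕ) lo k → (∀ i → f i ≡ lo + i) → applyUpTo f k ≡ range lo k
applyUpTo≡range f lo zero    _ = refl
applyUpTo≡range f lo (suc k) f≗ = cong₂ _∷_ (trans (f≗ 0) (+-identityʳ lo))
  (applyUpTo≡range (f ∘ suc) (suc lo) k (λ i → trans (f≗ (suc i)) (+-suc lo i)))

IsPerm⇔range : ∀ n σ → IsPerm n σ ⇔ (σ ↭ range 1 n)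
IsPerm⇔range n σ = mk⇔ (subst (σ ↭_) eq) (subst (σ ↭_) (sym eq))
  where
  eq : map suc (upTo n) ≡ range 1 n
  eq = trans (map-applyUpTo id suc n) (applyUpTo≡range suc 1 n (λ _ → refl))

∈-↭-range⁻ : ∀ {σ v} lo k → σ ↭ range lo k → v ∈ σ → lo ≤ v × v < lo + k
∈-↭-range⁻ lo k σ↭ v∈ = ∈-range⁻ lo k (∈-resp-↭ σ↭ v∈)

min∈ : ∀ {σ} lo k → σ ↭ range lo (suc k) → lo ∈ σ
min∈ lo k σ↭ = ∈-resp-↭ (↭-sym σ↭) (here refl)

max∈ : ∀ {σ} lo k → σ ↭ range lo (suc k) → lo + k ∈ σ
max∈ lo k σ↭ = ∈-resp-↭ (↭-sym σ↭) (max∈range lo k)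

↭-range-length : ∀ {σ} lo k → σ ↭ range lo k → length σ ≡ k
↭-range-length lo k σ↭ = trans (↭-length σ↭) (length-range lo k)

↭-range-≡ : ∀ {σ σ′} lo m n → σ ↭ range lo m → σ′ ↭ range lo n → σ ≡ σ′ → m ≡ n
↭-range-≡ lo m n σ↭ σ′↭ refl = trans (sym (↭-range-length lo m σ↭)) (↭-range-length lo n σ′↭)

↭-range⇒Unique : ∀ {σ} lo k → σ ↭ range lo k → Unique σ
↭-range⇒Unique lo k σ↭ = Setoid↭.Unique-resp-↭ (setoid ℕ) (↭⇒↭ₛ (↭-sym σ↭)) (Unique-range lo k)

range-max-first : ∀ lo k → range lo (suc (suc k)) ↭ lo + suc k ∷ range lo (suc k)
range-max-first lo k =
  subst (_↭ lo + suc k ∷ range lo (suc k)) (sym (range-∷ʳ lo (suc k))) (↭-sym (∷↭∷ʳ _ _))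

max-∷-↭ : ∀ {xs} lo k → xs ↭ range lo (suc k) → lo + suc k ∷ xs ↭ range lo (suc (suc k))
max-∷-↭ lo k xs↭ = ↭-trans (prep _ xs↭) (↭-sym (range-max-first lo k))

∷ʳ-↭ : ∀ {x : ℕ} {xs ys} → x ∷ xs ↭ ys → xs ∷ʳ x ↭ ys
∷ʳ-↭ = ↭-trans (↭-sym (∷↭∷ʳ _ _))

remove-↭ : ∀ ys {x : ℕ} {zs rs} → ys ++ x ∷ zs ↭ x ∷ rs → ys ++ zs ↭ rs
remove-↭ ys {x} {zs} p = drop-∷ (↭-trans (↭-sym (shift x ys zs)) p)

lo<hi : ∀ lo k → lo < lo + suc k
lo<hi lo k = m<m+n lo z<s

Unique⇒≢ : ∀ {x y : ℕ} {σ} → Unique σ → (x ∷ y ∷ []) ⊆ σ → x ≢ y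
Unique⇒≢ (_ ∷ u)   (skip _ s) = Unique⇒≢ u s
Unique⇒≢ (x≢ ∷ _) (refl ∷ s) = All.lookup x≢ (lookup s (here refl))

∈-tail : ∀ {x y : ℕ} {xs} → y ∈ x ∷ xs → x ≢ y → y ∈ xs
∈-tail (here refl) x≢x = ⊥-elim (x≢x refl)
∈-tail (there y∈)  _   = y∈

ordered-pair⊆ : ∀ {p q : ℕ} xs → p ∈ xs → q ∈ xs → p ≢ q → (p ∷ q ∷ []) ⊆ xs ⊎ (q ∷ p ∷ []) ⊆ xs
ordered-pair⊆ (x ∷ xs) (here refl) (here refl) p≢q = ⊥-elim (p≢q refl)
ordered-pair⊆ (x ∷ xs) (here refl) (there q∈)  _   = inj₁ (refl ∷ from∈ q∈)
ordered-pair⊆ (x ∷ xs) (there p∈)  (here refl) _   = inj₂ (refl ∷ from∈ p∈)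
ordered-pair⊆ (x ∷ xs) (there p∈)  (there q∈)  p≢q with ordered-pair⊆ xs p∈ q∈ p≢q
... | inj₁ s = inj₁ (skip x s)
... | inj₂ s = inj₂ (skip x s)

straddle⊆ : ∀ (y : ℕ) ys m z zs → (y ∷ m ∷ z ∷ []) ⊆ y ∷ ys ++ m ∷ z ∷ zs
straddle⊆ y ys m z zs = refl ∷ ++⁺ˡ ys (refl ∷ refl ∷ minimum zs)

ends⊆ : ∀ (y : ℕ) ys z zs → (y ∷ z ∷ []) ⊆ y ∷ ys ++ z ∷ zs
ends⊆ y ys z zs = refl ∷ ++⁺ˡ ys (refl ∷ minimum zs)

singleton≢ : ∀ {σ} lo k → σ ↭ range lo (suc (suc k)) → lo ∷ [] ≢ σ
singleton≢ lo k σ↭ eq with () ← trans (cong length eq) (↭-range-length lo _ σ↭)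

∷≡∷ʳ⇒∈ : ∀ {x y v : ℕ} {xs ys} → v ∈ ys → x ∷ xs ≡ ys ∷ʳ y → x ∈ ys
∷≡∷ʳ⇒∈ {ys = z ∷ zs} _ eq = subst (_∈ z ∷ zs) (sym (∷-injectiveˡ eq)) (here refl)

-- Bit strings

hasTrue hasFalse : List Bool → Bool
hasTrue  []      = false
hasTrue  (x ∷ b) = x ∨ hasTrue b
hasFalse []      = false
hasFalse (x ∷ b) = not x ∨ hasFalse b

trueBeforeFalse falseBeforeTrue : List Bool → Bool
trueBeforeFalse []          = false
trueBeforeFalse (true ∷ b)  = hasFalse b
trueBeforeFalse (false ∷ b) = trueBeforeFalse b
falseBeforeTrue []          = false
falseBeforeTrue (true ∷ b)  = falseBeforeTrue b
falseBeforeTrue (false ∷ b) = hasTrue b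

trueBeforeFalse⇒hasFalse : ∀ b → T (trueBeforeFalse b) → T (hasFalse b)
trueBeforeFalse⇒hasFalse (true ∷ b)  t = t
trueBeforeFalse⇒hasFalse (false ∷ b) _ = tt

falseBeforeTrue⇒hasTrue : ∀ b → T (falseBeforeTrue b) → T (hasTrue b)
falseBeforeTrue⇒hasTrue (true ∷ b)  _ = tt
falseBeforeTrue⇒hasTrue (false ∷ b) t = t

nonconstant nonmonotone : List Bool → Bool
nonconstant b = trueBeforeFalse b ∨ falseBeforeTrue b
nonmonotone b = trueBeforeFalse b ∧ falseBeforeTrue b

nonconstant-true∷ : ∀ b → nonconstant (true ∷ b) ≡ hasFalse b
nonconstant-true∷ []          = refl
nonconstant-true∷ (true ∷ b)  = nonconstant-true∷ b
nonconstant-true∷ (false ∷ b) = refl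

nonconstant-false∷ : ∀ b → nonconstant (false ∷ b) ≡ hasTrue b
nonconstant-false∷ []          = refl
nonconstant-false∷ (true ∷ b)  = ∨-zeroʳ (hasFalse b)
nonconstant-false∷ (false ∷ b) = nonconstant-false∷ b

nonmonotone-true∷ : ∀ b → nonmonotone (true ∷ b) ≡ falseBeforeTrue b
nonmonotone-true∷ []          = refl
nonmonotone-true∷ (true ∷ b)  = nonmonotone-true∷ b
nonmonotone-true∷ (false ∷ b) = refl

nonmonotone-false∷ : ∀ b → nonmonotone (false ∷ b) ≡ trueBeforeFalse b
nonmonotone-false∷ []          = refl
nonmonotone-false∷ (true ∷ b)  = ∧-identityʳ (hasFalse b)
nonmonotone-false∷ (false ∷ b) = nonmonotone-false∷ b

-- The four encodings

hi : ℕ → List Bool → ℕ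
hi lo b = lo + length b

peelLeft : ℕ → List Bool → List ℕ
peelLeft lo []          = lo ∷ []
peelLeft lo (true ∷ b)  = lo ∷ peelLeft (suc lo) b
peelLeft lo (false ∷ b) = hi lo (false ∷ b) ∷ peelLeft lo b

peelRight : ℕ → List Bool → List ℕ
peelRight lo b = reverse (peelLeft lo b)

valley : ℕ → List Bool → List ℕ
valley lo []          = lo ∷ []
valley lo (true ∷ b)  = hi lo (true ∷ b) ∷ valley lo b
valley lo (false ∷ b) = valley lo b ∷ʳ hi lo (false ∷ b)

mountain : ℕ → List Bool → List ℕ
mountain lo []          = lo ∷ []
mountain lo (true ∷ b)  = lo ∷ mountain (suc lo) b
mountain lo (false ∷ b) = mountain (suc lo) b ∷ʳ lo

peelLeft-↭ : ∀ lo b → peelLeft lo b ↭ range lo (suc (length b))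
peelLeft-↭ lo []          = ↭-refl
peelLeft-↭ lo (true ∷ b)  = prep lo (peelLeft-↭ (suc lo) b)
peelLeft-↭ lo (false ∷ b) = max-∷-↭ lo (length b) (peelLeft-↭ lo b)

peelRight-↭ : ∀ lo b → peelRight lo b ↭ range lo (suc (length b))
peelRight-↭ lo b = ↭-trans (↭-reverse (peelLeft lo b)) (peelLeft-↭ lo b)

valley-↭ : ∀ lo b → valley lo b ↭ range lo (suc (length b))
valley-↭ lo []          = ↭-refl
valley-↭ lo (true ∷ b)  = max-∷-↭ lo (length b) (valley-↭ lo b)
valley-↭ lo (false ∷ b) = ∷ʳ-↭ (max-∷-↭ lo (length b) (valley-↭ lo b))

mountain-↭ : ∀ lo b → mountain lo b ↭ range lo (suc (length b))
mountain-↭ lo []          = ↭-refl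
mountain-↭ lo (true ∷ b)  = prep lo (mountain-↭ (suc lo) b)
mountain-↭ lo (false ∷ b) = ∷ʳ-↭ (prep lo (mountain-↭ (suc lo) b))

peelLeft-entries : ∀ {v} lo b → v ∈ peelLeft lo b → lo ≤ v × v < lo + suc (length b)
peelLeft-entries lo b = ∈-↭-range⁻ lo _ (peelLeft-↭ lo b)

valley-entries : ∀ {v} lo b → v ∈ valley lo b → lo ≤ v × v < lo + suc (length b)
valley-entries lo b = ∈-↭-range⁻ lo _ (valley-↭ lo b)

mountain-entries : ∀ {v} lo b → v ∈ mountain lo b → lo ≤ v × v < lo + suc (length b)
mountain-entries lo b = ∈-↭-range⁻ lo _ (mountain-↭ lo b)

FirstInMiddle MiddleIsMax MiddleIsMin : Rel₃ → Set
FirstInMiddle R = ∀ {a b c} → R a b c → (b < a × a < c) ⊎ (c < a × a < b)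
MiddleIsMax   R = ∀ {a b c} → R a b c → a < b × c < b
MiddleIsMin   R = ∀ {a b c} → R a b c → b < a × b < c

peelLeft-avoids : ∀ {R} → FirstInMiddle R → ∀ lo b → ¬ Occurs₃ R (peelLeft lo b)
peelLeft-avoids mid lo []          = ¬Occurs₃-[x]
peelLeft-avoids mid lo (true ∷ b)  o with Occurs₃-∷⁻ o
... | inj₁ o′ = peelLeft-avoids mid (suc lo) b o′
... | inj₂ (y , z , s , r) with mid r
...   | inj₁ (y<lo , _) = <-asym y<lo (proj₁ (peelLeft-entries (suc lo) b (first∈ s)))
...   | inj₂ (z<lo , _) = <-asym z<lo (proj₁ (peelLeft-entries (suc lo) b (second∈ s)))
peelLeft-avoids mid lo (false ∷ b) o with Occurs₃-∷⁻ o
... | inj₁ o′ = peelLeft-avoids mid lo b o′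
... | inj₂ (y , z , s , r) with mid r
...   | inj₁ (_ , hi<z) = <-asym hi<z (proj₂ (peelLeft-entries lo b (second∈ s)))
...   | inj₂ (_ , hi<y) = <-asym hi<y (proj₂ (peelLeft-entries lo b (first∈ s)))

valley-avoids : ∀ {R} → MiddleIsMax R → ∀ lo b → ¬ Occurs₃ R (valley lo b)
valley-avoids peak lo []          = ¬Occurs₃-[x]
valley-avoids peak lo (true ∷ b)  o with Occurs₃-∷⁻ o
... | inj₁ o′              = valley-avoids peak lo b o′
... | inj₂ (y , z , s , r) = <-asym (proj₁ (peak r)) (proj₂ (valley-entries lo b (first∈ s)))
valley-avoids peak lo (false ∷ b) o with Occurs₃-∷ʳ⁻ (valley lo b) o
... | inj₁ o′              = valley-avoids peak lo b o′
... | inj₂ (x , y , s , r) = <-asym (proj₂ (peak r)) (proj₂ (valley-entries lo b (second∈ s)))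

mountain-avoids : ∀ {R} → MiddleIsMin R → ∀ lo b → ¬ Occurs₃ R (mountain lo b)
mountain-avoids dip lo []          = ¬Occurs₃-[x]
mountain-avoids dip lo (true ∷ b)  o with Occurs₃-∷⁻ o
... | inj₁ o′              = mountain-avoids dip (suc lo) b o′
... | inj₂ (y , z , s , r) = <-asym (proj₁ (dip r)) (proj₁ (mountain-entries (suc lo) b (first∈ s)))
mountain-avoids dip lo (false ∷ b) o with Occurs₃-∷ʳ⁻ (mountain (suc lo) b) o
... | inj₁ o′              = mountain-avoids dip (suc lo) b o′
... | inj₂ (x , y , s , r) = <-asym (proj₂ (dip r)) (proj₁ (mountain-entries (suc lo) b (second∈ s)))

peelLeft-𝒲₂ : ∀ lo b → 𝒲₂ (peelLeft lo b)
peelLeft-𝒲₂ lo b = peelLeft-avoids inj₁ lo b , peelLeft-avoids inj₂ lo b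

peelRight-𝒲₁ : ∀ lo b → 𝒲₁ (peelRight lo b)
peelRight-𝒲₁ lo b =
  peelLeft-avoids inj₂ lo b ∘ Equivalence.to (Occurs₃-reverse⇔ (peelLeft lo b)) ,
  peelLeft-avoids inj₁ lo b ∘ Equivalence.to (Occurs₃-reverse⇔ (peelLeft lo b))

valley-𝒲₃ : ∀ lo b → 𝒲₃ (valley lo b)
valley-𝒲₃ lo b =
  valley-avoids (λ (a<c , c<b) → <-trans a<c c<b , c<b) lo b ,
  valley-avoids (λ (c<a , a<b) → a<b , <-trans c<a a<b) lo b

mountain-𝒲₄ : ∀ lo b → 𝒲₄ (mountain lo b)
mountain-𝒲₄ lo b =
  mountain-avoids (λ (b<a , a<c) → b<a , <-trans b<a a<c) lo b ,
  mountain-avoids (λ (b<c , c<a) → <-trans b<c c<a , b<c) lo b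

peelLeft-complete : ∀ k lo σ → σ ↭ range lo (suc k) → 𝒲₂ σ → ∃[ b ] length b ≡ k × σ ≡ peelLeft lo b
peelLeft-complete zero    lo σ        σ↭ _ = [] , refl , ↭-singleton-inv σ↭
peelLeft-complete (suc k) lo []       σ↭ _ with () ← ↭-length σ↭
peelLeft-complete (suc k) lo (x ∷ xs) σ↭ av with x ≟ lo | x ≟ lo + suc k
... | yes refl | _ with peelLeft-complete k (suc lo) xs (drop-∷ σ↭) (Avoids-⊆ (skip x ⊆-refl) av)
...   | b , refl , refl = true ∷ b , refl , refl
peelLeft-complete (suc k) lo (x ∷ xs) σ↭ av | no _ | yes refl
  with peelLeft-complete k lo xs (drop-∷ (↭-trans σ↭ (range-max-first lo k))) (Avoids-⊆ (skip x ⊆-refl) av)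
...   | b , refl , refl = false ∷ b , refl , refl
peelLeft-complete (suc k) lo (x ∷ xs) σ↭ (¬213 , ¬231) | no x≢lo | no x≢max =
  ⊥-elim (between (ordered-pair⊆ xs (∈-tail (min∈ lo _ σ↭) x≢lo) (∈-tail (max∈ lo _ σ↭) x≢max)
                                  (<⇒≢ (lo<hi lo k))))
  where
  lo<x : lo < x
  lo<x = ≤∧≢⇒< (proj₁ (∈-↭-range⁻ lo _ σ↭ (here refl))) (x≢lo ∘ sym)
  x<max : x < lo + suc k
  x<max = ≤∧≢⇒< (m<1+n⇒m≤n (subst (x <_) (+-suc lo (suc k)) (proj₂ (∈-↭-range⁻ lo _ σ↭ (here refl)))))
                x≢max
  between : (lo ∷ lo + suc k ∷ []) ⊆ xs ⊎ (lo + suc k ∷ lo ∷ []) ⊆ xs → ⊥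
  between (inj₁ s) = ¬213 (x , lo , lo + suc k , refl ∷ s , lo<x , x<max)
  between (inj₂ s) = ¬231 (x , lo + suc k , lo , refl ∷ s , lo<x , x<max)

peelRight-complete : ∀ k lo σ → σ ↭ range lo (suc k) → 𝒲₁ σ → ∃[ b ] length b ≡ k × σ ≡ peelRight lo b
peelRight-complete k lo σ σ↭ (¬132 , ¬312)
  with peelLeft-complete k lo (reverse σ) (↭-trans (↭-reverse σ) σ↭)
         (¬312 ∘ Equivalence.to (Occurs₃-reverse⇔ σ) , ¬132 ∘ Equivalence.to (Occurs₃-reverse⇔ σ))
... | b , len , eq = b , len , trans (sym (reverse-involutive σ)) (cong reverse eq)

valley-complete : ∀ k lo σ → σ ↭ range lo (suc k) → 𝒲₃ σ → ∃[ b ] length b ≡ k × σ ≡ valley lo b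
valley-complete zero    lo σ σ↭ _ = [] , refl , ↭-singleton-inv σ↭
valley-complete (suc k) lo σ σ↭ av with ∈-∃++ (max∈ lo (suc k) σ↭)
... | [] , zs , refl
  with valley-complete k lo zs (drop-∷ (↭-trans σ↭ (range-max-first lo k))) (Avoids-⊆ (skip _ ⊆-refl) av)
...   | b , refl , refl = true ∷ b , refl , refl
valley-complete (suc k) lo σ σ↭ av | ys@(_ ∷ _) , [] , refl
  with valley-complete k lo ys
         (subst (_↭ range lo (suc k)) (++-identityʳ ys) (remove-↭ ys (↭-trans σ↭ (range-max-first lo k))))
         (Avoids-⊆ (++⁺ʳ _ ⊆-refl) av)
...   | b , refl , ys≡ = false ∷ b , refl , cong (_∷ʳ (lo + suc (length b))) ys≡
valley-complete (suc k) lo σ σ↭ (¬132 , ¬231) | y ∷ ys , z ∷ zs , refl = ⊥-elim (max-inside (<-cmp y z))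
  where
  rest↭ : y ∷ ys ++ z ∷ zs ↭ range lo (suc k)
  rest↭ = remove-↭ (y ∷ ys) (↭-trans σ↭ (range-max-first lo k))
  y<max : y < lo + suc k
  y<max = proj₂ (∈-↭-range⁻ lo _ rest↭ (here refl))
  z<max : z < lo + suc k
  z<max = proj₂ (∈-↭-range⁻ lo _ rest↭ (second∈ (ends⊆ y ys z zs)))
  max-inside : Tri (y < z) (y ≡ z) (z < y) → ⊥
  max-inside (tri< y<z _ _) = ¬132 (y , _ , z , straddle⊆ y ys _ z zs , y<z , z<max)
  max-inside (tri≈ _ y≡z _) = Unique⇒≢ (↭-range⇒Unique lo _ rest↭) (ends⊆ y ys z zs) y≡z
  max-inside (tri> _ _ z<y) = ¬231 (y , _ , z , straddle⊆ y ys _ z zs , z<y , y<max)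

mountain-complete : ∀ k lo σ → σ ↭ range lo (suc k) → 𝒲₄ σ → ∃[ b ] length b ≡ k × σ ≡ mountain lo b
mountain-complete zero    lo σ σ↭ _ = [] , refl , ↭-singleton-inv σ↭
mountain-complete (suc k) lo σ σ↭ av with ∈-∃++ (min∈ lo (suc k) σ↭)
... | [] , zs , refl
  with mountain-complete k (suc lo) zs (drop-∷ σ↭) (Avoids-⊆ (skip _ ⊆-refl) av)
...   | b , refl , refl = true ∷ b , refl , refl
mountain-complete (suc k) lo σ σ↭ av | ys@(_ ∷ _) , [] , refl
  with mountain-complete k (suc lo) ys (subst (_↭ range (suc lo) (suc k)) (++-identityʳ ys) (remove-↭ ys σ↭))
         (Avoids-⊆ (++⁺ʳ _ ⊆-refl) av)
...   | b , refl , ys≡ = false ∷ b , refl , cong (_∷ʳ lo) ys≡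
mountain-complete (suc k) lo σ σ↭ (¬213 , ¬312) | y ∷ ys , z ∷ zs , refl = ⊥-elim (min-inside (<-cmp y z))
  where
  rest↭ : y ∷ ys ++ z ∷ zs ↭ range (suc lo) (suc k)
  rest↭ = remove-↭ (y ∷ ys) σ↭
  lo<y : lo < y
  lo<y = proj₁ (∈-↭-range⁻ (suc lo) _ rest↭ (here refl))
  lo<z : lo < z
  lo<z = proj₁ (∈-↭-range⁻ (suc lo) _ rest↭ (second∈ (ends⊆ y ys z zs)))
  min-inside : Tri (y < z) (y ≡ z) (z < y) → ⊥
  min-inside (tri< y<z _ _) = ¬213 (y , lo , z , straddle⊆ y ys lo z zs , lo<y , y<z)
  min-inside (tri≈ _ y≡z _) = Unique⇒≢ (↭-range⇒Unique (suc lo) _ rest↭) (ends⊆ y ys z zs) y≡z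
  min-inside (tri> _ _ z<y) = ¬312 (y , lo , z , straddle⊆ y ys lo z zs , lo<z , z<y)

peelLeft-injective : ∀ lo b b′ → peelLeft lo b ≡ peelLeft lo b′ → b ≡ b′
peelLeft-injective lo []          []           _  = refl
peelLeft-injective lo []          (x ∷ b′)     eq = ⊥-elim (singleton≢ lo _ (peelLeft-↭ lo (x ∷ b′)) eq)
peelLeft-injective lo (x ∷ b)     []           eq = ⊥-elim (singleton≢ lo _ (peelLeft-↭ lo (x ∷ b)) (sym eq))
peelLeft-injective lo (true ∷ b)  (true ∷ b′)  eq = cong (true ∷_) (peelLeft-injective (suc lo) b b′ (∷-injectiveʳ eq))
peelLeft-injective lo (false ∷ b) (false ∷ b′) eq = cong (false ∷_) (peelLeft-injective lo b b′ (∷-injectiveʳ eq))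
peelLeft-injective lo (true ∷ b)  (false ∷ b′) eq = ⊥-elim (<⇒≢ (lo<hi lo (length b′)) (∷-injectiveˡ eq))
peelLeft-injective lo (false ∷ b) (true ∷ b′)  eq = ⊥-elim (<⇒≢ (lo<hi lo (length b)) (sym (∷-injectiveˡ eq)))

peelRight-injective : ∀ lo b b′ → peelRight lo b ≡ peelRight lo b′ → b ≡ b′
peelRight-injective lo b b′ = peelLeft-injective lo b b′ ∘ reverse-injective

valley-injective : ∀ lo b b′ → valley lo b ≡ valley lo b′ → b ≡ b′
valley-injective lo []          []           _  = refl
valley-injective lo []          (x ∷ b′)     eq = ⊥-elim (singleton≢ lo _ (valley-↭ lo (x ∷ b′)) eq)
valley-injective lo (x ∷ b)     []           eq = ⊥-elim (singleton≢ lo _ (valley-↭ lo (x ∷ b)) (sym eq))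
valley-injective lo (true ∷ b)  (true ∷ b′)  eq = cong (true ∷_) (valley-injective lo b b′ (∷-injectiveʳ eq))
valley-injective lo (false ∷ b) (false ∷ b′) eq =
  cong (false ∷_) (valley-injective lo b b′ (∷ʳ-injectiveˡ (valley lo b) (valley lo b′) eq))
valley-injective lo (true ∷ b)  (false ∷ b′) eq = ⊥-elim (hi∉ (∷≡∷ʳ⇒∈ (min∈ lo _ (valley-↭ lo b′)) eq))
  where
  same-length : length b ≡ length b′
  same-length = suc-injective (suc-injective
    (↭-range-≡ lo _ _ (valley-↭ lo (true ∷ b)) (valley-↭ lo (false ∷ b′)) eq))
  hi∉ : lo + suc (length b) ∉ valley lo b′
  hi∉ hi∈ = <-irrefl (cong (λ n → lo + suc n) same-length) (proj₂ (valley-entries lo b′ hi∈))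
valley-injective lo (false ∷ b) (true ∷ b′)  eq = sym (valley-injective lo (true ∷ b′) (false ∷ b) (sym eq))

mountain-injective : ∀ lo b b′ → mountain lo b ≡ mountain lo b′ → b ≡ b′
mountain-injective lo []          []           _  = refl
mountain-injective lo []          (x ∷ b′)     eq = ⊥-elim (singleton≢ lo _ (mountain-↭ lo (x ∷ b′)) eq)
mountain-injective lo (x ∷ b)     []           eq = ⊥-elim (singleton≢ lo _ (mountain-↭ lo (x ∷ b)) (sym eq))
mountain-injective lo (true ∷ b)  (true ∷ b′)  eq =
  cong (true ∷_) (mountain-injective (suc lo) b b′ (∷-injectiveʳ eq))
mountain-injective lo (false ∷ b) (false ∷ b′) eq = cong (false ∷_)
  (mountain-injective (suc lo) b b′ (∷ʳ-injectiveˡ (mountain (suc lo) b) (mountain (suc lo) b′) eq))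
mountain-injective lo (true ∷ b)  (false ∷ b′) eq = ⊥-elim (<-irrefl refl (proj₁ (mountain-entries (suc lo) b′ lo∈)))
  where
  lo∈ : lo ∈ mountain (suc lo) b′
  lo∈ = ∷≡∷ʳ⇒∈ (min∈ (suc lo) _ (mountain-↭ (suc lo) b′)) eq
mountain-injective lo (false ∷ b) (true ∷ b′)  eq = sym (mountain-injective lo (true ∷ b′) (false ∷ b) (sym eq))

peelLeft-descent⇔ : ∀ lo b → Occurs₂ _>_ (peelLeft lo b) ⇔ T (hasFalse b)
peelLeft-descent⇔ lo b = mk⇔ (to lo b) (from lo b)
  where
  to : ∀ lo b → Occurs₂ _>_ (peelLeft lo b) → T (hasFalse b)
  to lo []          = ¬Occurs₂-[x]
  to lo (false ∷ b) _ = tt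
  to lo (true ∷ b)  o with Occurs₂-∷⁻ o
  ... | inj₁ o′              = to (suc lo) b o′
  ... | inj₂ (y , y∈ , y<lo) = ⊥-elim (<-asym y<lo (proj₁ (peelLeft-entries (suc lo) b y∈)))
  from : ∀ lo b → T (hasFalse b) → Occurs₂ _>_ (peelLeft lo b)
  from lo (true ∷ b)  t = Occurs₂-⊆ (skip lo ⊆-refl) (from (suc lo) b t)
  from lo (false ∷ b) _ = Occurs₂-∷⁺ (min∈ lo _ (peelLeft-↭ lo b)) (lo<hi lo (length b))

peelLeft-ascent⇔ : ∀ lo b → Occurs₂ _<_ (peelLeft lo b) ⇔ T (hasTrue b)
peelLeft-ascent⇔ lo b = mk⇔ (to lo b) (from lo b)
  where
  to : ∀ lo b → Occurs₂ _<_ (peelLeft lo b) → T (hasTrue b)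
  to lo []          = ¬Occurs₂-[x]
  to lo (true ∷ b)  _ = tt
  to lo (false ∷ b) o with Occurs₂-∷⁻ o
  ... | inj₁ o′              = to lo b o′
  ... | inj₂ (y , y∈ , hi<y) = ⊥-elim (<-asym hi<y (proj₂ (peelLeft-entries lo b y∈)))
  from : ∀ lo b → T (hasTrue b) → Occurs₂ _<_ (peelLeft lo b)
  from lo (true ∷ b)  _ = Occurs₂-∷⁺ (min∈ (suc lo) _ (peelLeft-↭ (suc lo) b)) ≤-refl
  from lo (false ∷ b) t = Occurs₂-⊆ (skip _ ⊆-refl) (from lo b t)

peelLeft-132⇔ : ∀ lo b → Occurs₃ Is132 (peelLeft lo b) ⇔ T (trueBeforeFalse b)
peelLeft-132⇔ lo b = mk⇔ (to lo b) (from lo b)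
  where
  to : ∀ lo b → Occurs₃ Is132 (peelLeft lo b) → T (trueBeforeFalse b)
  to lo []          = ¬Occurs₃-[x]
  to lo (true ∷ b)  o with Occurs₃-∷⁻ o
  ... | inj₁ o′                    = trueBeforeFalse⇒hasFalse b (to (suc lo) b o′)
  ... | inj₂ (y , z , s , _ , z<y) = Equivalence.to (peelLeft-descent⇔ (suc lo) b) (y , z , s , z<y)
  to lo (false ∷ b) o with Occurs₃-∷⁻ o
  ... | inj₁ o′                     = to lo b o′
  ... | inj₂ (y , z , s , hi<z , _) = ⊥-elim (<-asym hi<z (proj₂ (peelLeft-entries lo b (second∈ s))))
  from : ∀ lo b → T (trueBeforeFalse b) → Occurs₃ Is132 (peelLeft lo b)
  from lo (true ∷ b)  t =
    let y , z , s , z<y = Equivalence.from (peelLeft-descent⇔ (suc lo) b) t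
    in Occurs₃-∷⁺ (y , z , s , proj₁ (peelLeft-entries (suc lo) b (second∈ s)) , z<y)
  from lo (false ∷ b) t = Occurs₃-⊆ (skip _ ⊆-refl) (from lo b t)

peelLeft-312⇔ : ∀ lo b → Occurs₃ Is312 (peelLeft lo b) ⇔ T (falseBeforeTrue b)
peelLeft-312⇔ lo b = mk⇔ (to lo b) (from lo b)
  where
  to : ∀ lo b → Occurs₃ Is312 (peelLeft lo b) → T (falseBeforeTrue b)
  to lo []          = ¬Occurs₃-[x]
  to lo (false ∷ b) o with Occurs₃-∷⁻ o
  ... | inj₁ o′                    = falseBeforeTrue⇒hasTrue b (to lo b o′)
  ... | inj₂ (y , z , s , y<z , _) = Equivalence.to (peelLeft-ascent⇔ lo b) (y , z , s , y<z)
  to lo (true ∷ b)  o with Occurs₃-∷⁻ o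
  ... | inj₁ o′                     = to (suc lo) b o′
  ... | inj₂ (y , z , s , _ , z<lo) = ⊥-elim (<-asym z<lo (proj₁ (peelLeft-entries (suc lo) b (second∈ s))))
  from : ∀ lo b → T (falseBeforeTrue b) → Occurs₃ Is312 (peelLeft lo b)
  from lo (false ∷ b) t =
    let y , z , s , y<z = Equivalence.from (peelLeft-ascent⇔ lo b) t
    in Occurs₃-∷⁺ (y , z , s , y<z , proj₂ (peelLeft-entries lo b (second∈ s)))
  from lo (true ∷ b)  t = Occurs₃-⊆ (skip _ ⊆-refl) (from (suc lo) b t)

peelRight-231⇔ : ∀ lo b → Occurs₃ Is231 (peelRight lo b) ⇔ T (trueBeforeFalse b)
peelRight-231⇔ lo b = peelLeft-132⇔ lo b ⇔-∘ Occurs₃-reverse⇔ (peelLeft lo b)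

peelRight-213⇔ : ∀ lo b → Occurs₃ Is213 (peelRight lo b) ⇔ T (falseBeforeTrue b)
peelRight-213⇔ lo b = peelLeft-312⇔ lo b ⇔-∘ Occurs₃-reverse⇔ (peelLeft lo b)

valley-ascent⇔ : ∀ lo b → Occurs₂ _<_ (valley lo b) ⇔ T (hasFalse b)
valley-ascent⇔ lo b = mk⇔ (to lo b) (from lo b)
  where
  to : ∀ lo b → Occurs₂ _<_ (valley lo b) → T (hasFalse b)
  to lo []          = ¬Occurs₂-[x]
  to lo (false ∷ b) _ = tt
  to lo (true ∷ b)  o with Occurs₂-∷⁻ o
  ... | inj₁ o′              = to lo b o′
  ... | inj₂ (y , y∈ , hi<y) = ⊥-elim (<-asym hi<y (proj₂ (valley-entries lo b y∈)))
  from : ∀ lo b → T (hasFalse b) → Occurs₂ _<_ (valley lo b)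
  from lo (true ∷ b)  t = Occurs₂-⊆ (skip _ ⊆-refl) (from lo b t)
  from lo (false ∷ b) _ = Occurs₂-∷ʳ⁺ (min∈ lo _ (valley-↭ lo b)) (lo<hi lo (length b))

valley-descent⇔ : ∀ lo b → Occurs₂ _>_ (valley lo b) ⇔ T (hasTrue b)
valley-descent⇔ lo b = mk⇔ (to lo b) (from lo b)
  where
  to : ∀ lo b → Occurs₂ _>_ (valley lo b) → T (hasTrue b)
  to lo []          = ¬Occurs₂-[x]
  to lo (true ∷ b)  _ = tt
  to lo (false ∷ b) o with Occurs₂-∷ʳ⁻ (valley lo b) o
  ... | inj₁ o′              = to lo b o′
  ... | inj₂ (y , y∈ , hi<y) = ⊥-elim (<-asym hi<y (proj₂ (valley-entries lo b y∈)))
  from : ∀ lo b → T (hasTrue b) → Occurs₂ _>_ (valley lo b)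
  from lo (true ∷ b)  _ = Occurs₂-∷⁺ (min∈ lo _ (valley-↭ lo b)) (lo<hi lo (length b))
  from lo (false ∷ b) t = Occurs₂-⊆ (++⁺ʳ _ ⊆-refl) (from lo b t)

valley-312⇔ : ∀ lo b → Occurs₃ Is312 (valley lo b) ⇔ T (trueBeforeFalse b)
valley-312⇔ lo b = mk⇔ (to lo b) (from lo b)
  where
  to : ∀ lo b → Occurs₃ Is312 (valley lo b) → T (trueBeforeFalse b)
  to lo []          = ¬Occurs₃-[x]
  to lo (true ∷ b)  o with Occurs₃-∷⁻ o
  ... | inj₁ o′                    = trueBeforeFalse⇒hasFalse b (to lo b o′)
  ... | inj₂ (y , z , s , y<z , _) = Equivalence.to (valley-ascent⇔ lo b) (y , z , s , y<z)
  to lo (false ∷ b) o with Occurs₃-∷ʳ⁻ (valley lo b) o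
  ... | inj₁ o′                     = to lo b o′
  ... | inj₂ (x , y , s , _ , hi<x) = ⊥-elim (<-asym hi<x (proj₂ (valley-entries lo b (first∈ s))))
  from : ∀ lo b → T (trueBeforeFalse b) → Occurs₃ Is312 (valley lo b)
  from lo (true ∷ b)  t =
    let y , z , s , y<z = Equivalence.from (valley-ascent⇔ lo b) t
    in Occurs₃-∷⁺ (y , z , s , y<z , proj₂ (valley-entries lo b (second∈ s)))
  from lo (false ∷ b) t = Occurs₃-⊆ (++⁺ʳ _ ⊆-refl) (from lo b t)

valley-213⇔ : ∀ lo b → Occurs₃ Is213 (valley lo b) ⇔ T (falseBeforeTrue b)
valley-213⇔ lo b = mk⇔ (to lo b) (from lo b)
  where
  to : ∀ lo b → Occurs₃ Is213 (valley lo b) → T (falseBeforeTrue b)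
  to lo []          = ¬Occurs₃-[x]
  to lo (false ∷ b) o with Occurs₃-∷ʳ⁻ (valley lo b) o
  ... | inj₁ o′                    = falseBeforeTrue⇒hasTrue b (to lo b o′)
  ... | inj₂ (x , y , s , y<x , _) = Equivalence.to (valley-descent⇔ lo b) (x , y , s , y<x)
  to lo (true ∷ b)  o with Occurs₃-∷⁻ o
  ... | inj₁ o′                     = to lo b o′
  ... | inj₂ (y , z , s , _ , hi<z) = ⊥-elim (<-asym hi<z (proj₂ (valley-entries lo b (second∈ s))))
  from : ∀ lo b → T (falseBeforeTrue b) → Occurs₃ Is213 (valley lo b)
  from lo (false ∷ b) t =
    let x , y , s , y<x = Equivalence.from (valley-descent⇔ lo b) t
    in Occurs₃-∷ʳ⁺ (x , y , s , y<x , proj₂ (valley-entries lo b (first∈ s)))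
  from lo (true ∷ b)  t = Occurs₃-⊆ (skip _ ⊆-refl) (from lo b t)

mountain-descent⇔ : ∀ lo b → Occurs₂ _>_ (mountain lo b) ⇔ T (hasFalse b)
mountain-descent⇔ lo b = mk⇔ (to lo b) (from lo b)
  where
  to : ∀ lo b → Occurs₂ _>_ (mountain lo b) → T (hasFalse b)
  to lo []          = ¬Occurs₂-[x]
  to lo (false ∷ b) _ = tt
  to lo (true ∷ b)  o with Occurs₂-∷⁻ o
  ... | inj₁ o′              = to (suc lo) b o′
  ... | inj₂ (y , y∈ , y<lo) = ⊥-elim (<-asym y<lo (proj₁ (mountain-entries (suc lo) b y∈)))
  from : ∀ lo b → T (hasFalse b) → Occurs₂ _>_ (mountain lo b)
  from lo (true ∷ b)  t = Occurs₂-⊆ (skip _ ⊆-refl) (from (suc lo) b t)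
  from lo (false ∷ b) _ = Occurs₂-∷ʳ⁺ (min∈ (suc lo) _ (mountain-↭ (suc lo) b)) ≤-refl

mountain-ascent⇔ : ∀ lo b → Occurs₂ _<_ (mountain lo b) ⇔ T (hasTrue b)
mountain-ascent⇔ lo b = mk⇔ (to lo b) (from lo b)
  where
  to : ∀ lo b → Occurs₂ _<_ (mountain lo b) → T (hasTrue b)
  to lo []          = ¬Occurs₂-[x]
  to lo (true ∷ b)  _ = tt
  to lo (false ∷ b) o with Occurs₂-∷ʳ⁻ (mountain (suc lo) b) o
  ... | inj₁ o′              = to (suc lo) b o′
  ... | inj₂ (y , y∈ , y<lo) = ⊥-elim (<-asym y<lo (proj₁ (mountain-entries (suc lo) b y∈)))
  from : ∀ lo b → T (hasTrue b) → Occurs₂ _<_ (mountain lo b)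
  from lo (true ∷ b)  _ = Occurs₂-∷⁺ (min∈ (suc lo) _ (mountain-↭ (suc lo) b)) ≤-refl
  from lo (false ∷ b) t = Occurs₂-⊆ (++⁺ʳ _ ⊆-refl) (from (suc lo) b t)

mountain-132⇔ : ∀ lo b → Occurs₃ Is132 (mountain lo b) ⇔ T (trueBeforeFalse b)
mountain-132⇔ lo b = mk⇔ (to lo b) (from lo b)
  where
  to : ∀ lo b → Occurs₃ Is132 (mountain lo b) → T (trueBeforeFalse b)
  to lo []          = ¬Occurs₃-[x]
  to lo (true ∷ b)  o with Occurs₃-∷⁻ o
  ... | inj₁ o′                    = trueBeforeFalse⇒hasFalse b (to (suc lo) b o′)
  ... | inj₂ (y , z , s , _ , z<y) = Equivalence.to (mountain-descent⇔ (suc lo) b) (y , z , s , z<y)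
  to lo (false ∷ b) o with Occurs₃-∷ʳ⁻ (mountain (suc lo) b) o
  ... | inj₁ o′                     = to (suc lo) b o′
  ... | inj₂ (x , y , s , x<lo , _) = ⊥-elim (<-asym x<lo (proj₁ (mountain-entries (suc lo) b (first∈ s))))
  from : ∀ lo b → T (trueBeforeFalse b) → Occurs₃ Is132 (mountain lo b)
  from lo (true ∷ b)  t =
    let y , z , s , z<y = Equivalence.from (mountain-descent⇔ (suc lo) b) t
    in Occurs₃-∷⁺ (y , z , s , proj₁ (mountain-entries (suc lo) b (second∈ s)) , z<y)
  from lo (false ∷ b) t = Occurs₃-⊆ (++⁺ʳ _ ⊆-refl) (from (suc lo) b t)

mountain-231⇔ : ∀ lo b → Occurs₃ Is231 (mountain lo b) ⇔ T (falseBeforeTrue b)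
mountain-231⇔ lo b = mk⇔ (to lo b) (from lo b)
  where
  to : ∀ lo b → Occurs₃ Is231 (mountain lo b) → T (falseBeforeTrue b)
  to lo []          = ¬Occurs₃-[x]
  to lo (false ∷ b) o with Occurs₃-∷ʳ⁻ (mountain (suc lo) b) o
  ... | inj₁ o′                    = falseBeforeTrue⇒hasTrue b (to (suc lo) b o′)
  ... | inj₂ (x , y , s , _ , x<y) = Equivalence.to (mountain-ascent⇔ (suc lo) b) (x , y , s , x<y)
  to lo (true ∷ b)  o with Occurs₃-∷⁻ o
  ... | inj₁ o′                     = to (suc lo) b o′
  ... | inj₂ (y , z , s , z<lo , _) = ⊥-elim (<-asym z<lo (proj₁ (mountain-entries (suc lo) b (second∈ s))))
  from : ∀ lo b → T (falseBeforeTrue b) → Occurs₃ Is231 (mountain lo b)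
  from lo (false ∷ b) t =
    let x , y , s , x<y = Equivalence.from (mountain-ascent⇔ (suc lo) b) t
    in Occurs₃-∷ʳ⁺ (x , y , s , proj₁ (mountain-entries (suc lo) b (first∈ s)) , x<y)
  from lo (true ∷ b)  t = Occurs₃-⊆ (skip _ ⊆-refl) (from (suc lo) b t)

-- Counting bit strings

bitStrings : ℕ → List (List Bool)
bitStrings zero    = [] ∷ []
bitStrings (suc m) = map (true ∷_) (bitStrings m) ++ map (false ∷_) (bitStrings m)

∈-bitStrings⁺ : ∀ b → b ∈ bitStrings (length b)
∈-bitStrings⁺ []          = here refl
∈-bitStrings⁺ (true ∷ b)  = ∈-++⁺ˡ (∈-map⁺ (true ∷_) (∈-bitStrings⁺ b))
∈-bitStrings⁺ (false ∷ b) = ∈-++⁺ʳ (map (true ∷_) (bitStrings (length b))) (∈-map⁺ (false ∷_) (∈-bitStrings⁺ b))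

∈-bitStrings⁻ : ∀ m {b} → b ∈ bitStrings m → length b ≡ m
∈-bitStrings⁻ zero    (here refl) = refl
∈-bitStrings⁻ (suc m) b∈ with ∈-++⁻ (map (true ∷_) (bitStrings m)) b∈
... | inj₁ b∈ᵗ with _ , c∈ , refl ← ∈-map⁻ (true ∷_) b∈ᵗ  = cong suc (∈-bitStrings⁻ m c∈)
... | inj₂ b∈ᶠ with _ , c∈ , refl ← ∈-map⁻ (false ∷_) b∈ᶠ = cong suc (∈-bitStrings⁻ m c∈)

length-bitStrings : ∀ m → length (bitStrings m) ≡ 2 ^ m
length-bitStrings zero    = refl
length-bitStrings (suc m) = begin
  length (map (true ∷_) (bitStrings m) ++ map (false ∷_) (bitStrings m))
    ≡⟨ length-++ (map (true ∷_) (bitStrings m)) ⟩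
  length (map (true ∷_) (bitStrings m)) + length (map (false ∷_) (bitStrings m))
    ≡⟨ cong₂ _+_ (length-map (true ∷_) (bitStrings m)) (length-map (false ∷_) (bitStrings m)) ⟩
  length (bitStrings m) + length (bitStrings m)
    ≡⟨ cong (λ n → n + n) (length-bitStrings m) ⟩
  2 ^ m + 2 ^ m
    ≡⟨ cong (2 ^ m +_) (sym (+-identityʳ (2 ^ m))) ⟩
  2 ^ suc m ∎
  where open ≡-Reasoning

Unique-bitStrings : ∀ m → Unique (bitStrings m)
Unique-bitStrings zero    = All.[] ∷ []
Unique-bitStrings (suc m) =
  Unique.++⁺ (Unique.map⁺ ∷-injectiveʳ (Unique-bitStrings m)) (Unique.map⁺ ∷-injectiveʳ (Unique-bitStrings m))
             disjoint
  where
  disjoint : ∀ {b} → ¬ (b ∈ map (true ∷_) (bitStrings m) × b ∈ map (false ∷_) (bitStrings m))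
  disjoint (b∈ᵗ , b∈ᶠ) with ∈-map⁻ (true ∷_) b∈ᵗ | ∈-map⁻ (false ∷_) b∈ᶠ
  ... | _ , _ , refl | _ , _ , ()

length-filterᵇ-map : ∀ {A B : Set} (p : B → Bool) (f : A → B) xs →
                     length (filterᵇ p (map f xs)) ≡ length (filterᵇ (p ∘ f) xs)
length-filterᵇ-map p f []       = refl
length-filterᵇ-map p f (x ∷ xs) with p (f x)
... | true  = cong suc (length-filterᵇ-map p f xs)
... | false = length-filterᵇ-map p f xs

length-filterᵇ-complement : ∀ {A : Set} (p : A → Bool) xs →
                            length (filterᵇ p xs) + length (filterᵇ (not ∘ p) xs) ≡ length xs
length-filterᵇ-complement p []       = refl
length-filterᵇ-complement p (x ∷ xs) with p x
... | true  = cong suc (length-filterᵇ-complement p xs)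
... | false = trans (+-suc _ _) (cong suc (length-filterᵇ-complement p xs))

count : (List Bool → Bool) → ℕ → ℕ
count p m = length (filterᵇ p (bitStrings m))

count-suc : ∀ p m → count p (suc m) ≡ count (p ∘ (true ∷_)) m + count (p ∘ (false ∷_)) m
count-suc p m = begin
  length (filterᵇ p (map (true ∷_) bits ++ map (false ∷_) bits))
    ≡⟨ cong length (filter-++ (T? ∘ p) (map (true ∷_) bits) (map (false ∷_) bits)) ⟩
  length (filterᵇ p (map (true ∷_) bits) ++ filterᵇ p (map (false ∷_) bits))
    ≡⟨ length-++ (filterᵇ p (map (true ∷_) bits)) ⟩
  length (filterᵇ p (map (true ∷_) bits)) + length (filterᵇ p (map (false ∷_) bits))
    ≡⟨ cong₂ _+_ (length-filterᵇ-map p (true ∷_) bits) (length-filterᵇ-map p (false ∷_) bits) ⟩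
  count (p ∘ (true ∷_)) m + count (p ∘ (false ∷_)) m ∎
  where
  open ≡-Reasoning
  bits = bitStrings m

count-cong : ∀ {p q} m → (∀ b → p b ≡ q b) → count p m ≡ count q m
count-cong m p≗q = cong length
  (filter-≐ (T? ∘ _) (T? ∘ _) ((λ {b} → subst T (p≗q b)) , (λ {b} → subst T (sym (p≗q b)))) (bitStrings m))

count-complement : ∀ p m → count p m + count (not ∘ p) m ≡ 2 ^ m
count-complement p m = trans (length-filterᵇ-complement p (bitStrings m)) (length-bitStrings m)

count-false : ∀ m → count (λ _ → false) m ≡ 0
count-false m = cong length (filter-none (T? ∘ (λ _ → false)) (All.universal (λ _ ()) (bitStrings m)))

count-true : ∀ m → count (λ _ → true) m ≡ 2 ^ m
count-true m = trans (sym (+-identityʳ _)) (trans (cong (count (λ _ → true) m +_) (sym (count-false m)))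
                                                   (count-complement (λ _ → true) m))

count-¬hasFalse : ∀ m → count (not ∘ hasFalse) m ≡ 1
count-¬hasFalse zero    = refl
count-¬hasFalse (suc m) = trans (count-suc (not ∘ hasFalse) m) (cong₂ _+_ (count-¬hasFalse m) (count-false m))

count-¬hasTrue : ∀ m → count (not ∘ hasTrue) m ≡ 1
count-¬hasTrue zero    = refl
count-¬hasTrue (suc m) = trans (count-suc (not ∘ hasTrue) m) (cong₂ _+_ (count-false m) (count-¬hasTrue m))

count-¬trueBeforeFalse : ∀ m → count (not ∘ trueBeforeFalse) m ≡ suc m
count-¬trueBeforeFalse zero    = refl
count-¬trueBeforeFalse (suc m) =
  trans (count-suc (not ∘ trueBeforeFalse) m) (cong₂ _+_ (count-¬hasFalse m) (count-¬trueBeforeFalse m))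

count-¬falseBeforeTrue : ∀ m → count (not ∘ falseBeforeTrue) m ≡ suc m
count-¬falseBeforeTrue zero    = refl
count-¬falseBeforeTrue (suc m) =
  trans (count-suc (not ∘ falseBeforeTrue) m)
        (trans (cong₂ _+_ (count-¬falseBeforeTrue m) (count-¬hasTrue m)) (+-comm (suc m) 1))

count-nonconstant : ∀ m → count nonconstant (suc m) + 2 ≡ 2 ^ suc m
count-nonconstant m = trans (cong (count nonconstant (suc m) +_) (sym constant)) (count-complement nonconstant (suc m))
  where
  constant : count (not ∘ nonconstant) (suc m) ≡ 2
  constant = begin
    count (not ∘ nonconstant) (suc m)
      ≡⟨ count-suc (not ∘ nonconstant) m ⟩
    count (λ b → not (nonconstant (true ∷ b))) m + count (λ b → not (nonconstant (false ∷ b))) m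
      ≡⟨ cong₂ _+_ (count-cong m (cong not ∘ nonconstant-true∷)) (count-cong m (cong not ∘ nonconstant-false∷)) ⟩
    count (not ∘ hasFalse) m + count (not ∘ hasTrue) m
      ≡⟨ cong₂ _+_ (count-¬hasFalse m) (count-¬hasTrue m) ⟩
    2 ∎
    where open ≡-Reasoning

count-nonmonotone : ∀ m → count nonmonotone (suc m) + (suc m + suc m) ≡ 2 ^ suc m
count-nonmonotone m = trans (cong (count nonmonotone (suc m) +_) (sym monotone)) (count-complement nonmonotone (suc m))
  where
  monotone : count (not ∘ nonmonotone) (suc m) ≡ suc m + suc m
  monotone = begin
    count (not ∘ nonmonotone) (suc m)
      ≡⟨ count-suc (not ∘ nonmonotone) m ⟩
    count (λ b → not (nonmonotone (true ∷ b))) m + count (λ b → not (nonmonotone (false ∷ b))) m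
      ≡⟨ cong₂ _+_ (count-cong m (cong not ∘ nonmonotone-true∷)) (count-cong m (cong not ∘ nonmonotone-false∷)) ⟩
    count (not ∘ falseBeforeTrue) m + count (not ∘ trueBeforeFalse) m
      ≡⟨ cong₂ _+_ (count-¬falseBeforeTrue m) (count-¬trueBeforeFalse m) ⟩
    suc m + suc m ∎
    where open ≡-Reasoning

-- The census of 𝒲

Encodings : (List Bool → List ℕ) → (List Bool → Bool) → ℕ → List (List ℕ)
Encodings E p m = map E (filterᵇ p (bitStrings m))

∈-Encodings⁺ : ∀ {E p} b → T (p b) → E b ∈ Encodings E p (length b)
∈-Encodings⁺ {E} {p} b t = ∈-map⁺ E (∈-filter⁺ (T? ∘ p) (∈-bitStrings⁺ b) t)

All-Encodings : ∀ {Q : List ℕ → Set} {E p} m → (∀ b → length b ≡ m → T (p b) → Q (E b)) → All Q (Encodings E p m)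
All-Encodings {Q = Q} {E} {p} m Q-E = All.tabulate λ σ∈ →
  let b , b∈ , σ≡ , t = ∈-map∘filter⁻ E (T? ∘ p) σ∈ in subst Q (sym σ≡) (Q-E b (∈-bitStrings⁻ m b∈) t)

Unique-Encodings : ∀ {E p} m → (∀ {b b′} → E b ≡ E b′ → b ≡ b′) → Unique (Encodings E p m)
Unique-Encodings {p = p} m E-injective = Unique.map⁺ E-injective (Unique.filter⁺ (T? ∘ p) (Unique-bitStrings m))

length-Encodings : ∀ E p m → length (Encodings E p m) ≡ count p m
length-Encodings E p m = length-map E (filterᵇ p (bitStrings m))

All⇒Disjoint : ∀ {P : List ℕ → Set} {xs ys} → All P xs → All (¬_ ∘ P) ys → Disjoint xs ys
All⇒Disjoint Pxs ¬Pys (v∈xs , v∈ys) = All.lookup ¬Pys v∈ys (All.lookup Pxs v∈xs)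

-- L lists 𝒲₂, 𝒲₁ ∖ 𝒲₂, 𝒲₃ ∖ (𝒲₁ ∪ 𝒲₂) and 𝒲₄ ∖ (𝒲₁ ∪ 𝒲₂ ∪ 𝒲₃), restricted to permutations of
-- 1, …, m + 1.
module Census (m : ℕ) where

  A B C D L : List (List ℕ)
  A = Encodings (peelLeft 1)  (λ _ → true) m
  B = Encodings (peelRight 1) nonconstant  m
  C = Encodings (valley 1)    nonmonotone  m
  D = Encodings (mountain 1)  nonmonotone  m
  L = A ++ B ++ C ++ D

  Perm : List ℕ → Set
  Perm σ = σ ↭ range 1 (suc m)

  A-𝒲₂ : All 𝒲₂ A
  A-𝒲₂ = All-Encodings m (λ b _ _ → peelLeft-𝒲₂ 1 b)

  B-𝒲₁ : All 𝒲₁ B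
  B-𝒲₁ = All-Encodings m (λ b _ _ → peelRight-𝒲₁ 1 b)

  C-𝒲₃ : All 𝒲₃ C
  C-𝒲₃ = All-Encodings m (λ b _ _ → valley-𝒲₃ 1 b)

  B-¬𝒲₂ : All (¬_ ∘ 𝒲₂) B
  B-¬𝒲₂ = All-Encodings m λ b _ t (¬213 , ¬231) → case Equivalence.to T-∨ t of λ where
    (inj₁ tf) → ¬231 (Equivalence.from (peelRight-231⇔ 1 b) tf)
    (inj₂ ft) → ¬213 (Equivalence.from (peelRight-213⇔ 1 b) ft)

  C-¬𝒲₁ : All (¬_ ∘ 𝒲₁) C
  C-¬𝒲₁ = All-Encodings m λ b _ t (_ , ¬312) →
    ¬312 (Equivalence.from (valley-312⇔ 1 b) (proj₁ (Equivalence.to T-∧ t)))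

  C-¬𝒲₂ : All (¬_ ∘ 𝒲₂) C
  C-¬𝒲₂ = All-Encodings m λ b _ t (¬213 , _) →
    ¬213 (Equivalence.from (valley-213⇔ 1 b) (proj₂ (Equivalence.to T-∧ t)))

  D-¬𝒲₁ : All (¬_ ∘ 𝒲₁) D
  D-¬𝒲₁ = All-Encodings m λ b _ t (¬132 , _) →
    ¬132 (Equivalence.from (mountain-132⇔ 1 b) (proj₁ (Equivalence.to T-∧ t)))

  D-¬𝒲₂ : All (¬_ ∘ 𝒲₂) D
  D-¬𝒲₂ = All-Encodings m λ b _ t (_ , ¬231) →
    ¬231 (Equivalence.from (mountain-231⇔ 1 b) (proj₂ (Equivalence.to T-∧ t)))

  D-¬𝒲₃ : All (¬_ ∘ 𝒲₃) D
  D-¬𝒲₃ = All-Encodings m λ b _ t (¬132 , _) →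
    ¬132 (Equivalence.from (mountain-132⇔ 1 b) (proj₁ (Equivalence.to T-∧ t)))

  Unique-L : Unique L
  Unique-L =
    Unique.++⁺ (Unique-Encodings m (peelLeft-injective 1 _ _))
      (Unique.++⁺ (Unique-Encodings m (peelRight-injective 1 _ _))
        (Unique.++⁺ (Unique-Encodings m (valley-injective 1 _ _))
                    (Unique-Encodings m (mountain-injective 1 _ _))
                    (All⇒Disjoint C-𝒲₃ D-¬𝒲₃))
        (All⇒Disjoint B-𝒲₁ (All.++⁺ C-¬𝒲₁ D-¬𝒲₁)))
      (All⇒Disjoint A-𝒲₂ (All.++⁺ B-¬𝒲₂ (All.++⁺ C-¬𝒲₂ D-¬𝒲₂)))

  length-L : length L ≡ 2 ^ m + (count nonconstant m + (count nonmonotone m + count nonmonotone m))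
  length-L = begin
    length (A ++ B ++ C ++ D)                   ≡⟨ length-++ A ⟩
    length A + length (B ++ C ++ D)             ≡⟨ cong (length A +_) (length-++ B) ⟩
    length A + (length B + length (C ++ D))     ≡⟨ cong (λ n → length A + (length B + n)) (length-++ C) ⟩
    length A + (length B + (length C + length D))
      ≡⟨ cong₂ _+_ (length-Encodings _ _ m)
          (cong₂ _+_ (length-Encodings _ _ m)
            (cong₂ _+_ (length-Encodings _ _ m) (length-Encodings _ _ m))) ⟩
    count (λ _ → true) m + (count nonconstant m + (count nonmonotone m + count nonmonotone m))
      ≡⟨ cong (_+ (count nonconstant m + (count nonmonotone m + count nonmonotone m))) (count-true m) ⟩
    2 ^ m + (count nonconstant m + (count nonmonotone m + count nonmonotone m)) ∎
    where open ≡-Reasoning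

  L-sound : All (λ σ → Perm σ × 𝒲 σ) L
  L-sound =
    All.++⁺ (All-Encodings m λ { b refl _ → peelLeft-↭ 1 b  , inj₂ (inj₁ (peelLeft-𝒲₂ 1 b)) })
   (All.++⁺ (All-Encodings m λ { b refl _ → peelRight-↭ 1 b , inj₁ (peelRight-𝒲₁ 1 b) })
   (All.++⁺ (All-Encodings m λ { b refl _ → valley-↭ 1 b    , inj₂ (inj₂ (inj₁ (valley-𝒲₃ 1 b))) })
            (All-Encodings m λ { b refl _ → mountain-↭ 1 b  , inj₂ (inj₂ (inj₂ (mountain-𝒲₄ 1 b))) })))

  𝒲₂⊆L : ∀ {σ} → Perm σ → 𝒲₂ σ → σ ∈ L
  𝒲₂⊆L σ↭ w with peelLeft-complete m 1 _ σ↭ w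
  ... | b , refl , refl = ∈-++⁺ˡ (∈-Encodings⁺ b tt)

  𝒲₁⊆L : ∀ {σ} → Perm σ → 𝒲₁ σ → σ ∈ L
  𝒲₁⊆L σ↭ w with peelRight-complete m 1 _ σ↭ w
  ... | b , refl , refl with T? (nonconstant b)
  ...   | yes t  = ∈-++⁺ʳ A (∈-++⁺ˡ (∈-Encodings⁺ b t))
  ...   | no ¬t  = 𝒲₂⊆L σ↭
    ( ¬t ∘ Equivalence.from T-∨ ∘ inj₂ ∘ Equivalence.to (peelRight-213⇔ 1 b)
    , ¬t ∘ Equivalence.from T-∨ ∘ inj₁ ∘ Equivalence.to (peelRight-231⇔ 1 b))

  𝒲₃⊆L : ∀ {σ} → Perm σ → 𝒲₃ σ → σ ∈ L
  𝒲₃⊆L σ↭ (¬132 , ¬231) with valley-complete m 1 _ σ↭ (¬132 , ¬231)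
  ... | b , refl , refl with T? (nonmonotone b) | T? (trueBeforeFalse b)
  ...   | yes t | _      = ∈-++⁺ʳ A (∈-++⁺ʳ B (∈-++⁺ˡ (∈-Encodings⁺ b t)))
  ...   | no _  | no ¬tf = 𝒲₁⊆L σ↭ (¬132 , ¬tf ∘ Equivalence.to (valley-312⇔ 1 b))
  ...   | no ¬t | yes tf =
    𝒲₂⊆L σ↭ (¬t ∘ Equivalence.from T-∧ ∘ (tf ,_) ∘ Equivalence.to (valley-213⇔ 1 b) , ¬231)

  𝒲₄⊆L : ∀ {σ} → Perm σ → 𝒲₄ σ → σ ∈ L
  𝒲₄⊆L σ↭ (¬213 , ¬312) with mountain-complete m 1 _ σ↭ (¬213 , ¬312)
  ... | b , refl , refl with T? (nonmonotone b) | T? (trueBeforeFalse b)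
  ...   | yes t | _      = ∈-++⁺ʳ A (∈-++⁺ʳ B (∈-++⁺ʳ C (∈-Encodings⁺ b t)))
  ...   | no _  | no ¬tf = 𝒲₁⊆L σ↭ (¬tf ∘ Equivalence.to (mountain-132⇔ 1 b) , ¬312)
  ...   | no ¬t | yes tf =
    𝒲₂⊆L σ↭ (¬213 , ¬t ∘ Equivalence.from T-∧ ∘ (tf ,_) ∘ Equivalence.to (mountain-231⇔ 1 b))

  L⇔ : ∀ σ → σ ∈ L ⇔ (Perm σ × 𝒲 σ)
  L⇔ σ = mk⇔ (All.lookup L-sound) λ where
    (σ↭ , inj₁ w)               → 𝒲₁⊆L σ↭ w
    (σ↭ , inj₂ (inj₁ w))        → 𝒲₂⊆L σ↭ w
    (σ↭ , inj₂ (inj₂ (inj₁ w))) → 𝒲₃⊆L σ↭ w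
    (σ↭ , inj₂ (inj₂ (inj₂ w))) → 𝒲₄⊆L σ↭ w

census-arithmetic : ∀ m P c d → c + 2 ≡ P → d + (m + m) ≡ P →
                    P + (c + (d + d)) ≡ (2 * (2 * P) ∸ 4 * suc m) + 2
census-arithmetic m P c d c+2≡P d+2m≡P = begin
  P + (c + (d + d))                            ≡⟨ cong (_+ (c + (d + d))) (sym c+2≡P) ⟩
  (c + 2) + (c + (d + d))                      ≡⟨ shift-2 c d ⟩
  (c + c + d + d) + 2                          ≡⟨ cong (_+ 2) (sym (m+n∸n≡m (c + c + d + d) (4 * suc m))) ⟩
  (c + c + d + d + 4 * suc m ∸ 4 * suc m) + 2  ≡⟨ cong (λ x → (x ∸ 4 * suc m) + 2) 4P≡ ⟩
  (2 * (2 * P) ∸ 4 * suc m) + 2                ∎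
  where
  open ≡-Reasoning
  shift-2 : ∀ c d → (c + 2) + (c + (d + d)) ≡ (c + c + d + d) + 2
  shift-2 = solve-∀
  regroup : ∀ c d m → c + c + d + d + 4 * suc m ≡ (c + 2) + (c + 2) + (d + (m + m)) + (d + (m + m))
  regroup = solve-∀
  quadruple : ∀ P → P + P + P + P ≡ 2 * (2 * P)
  quadruple = solve-∀
  4P≡ : c + c + d + d + 4 * suc m ≡ 2 * (2 * P)
  4P≡ = begin
    c + c + d + d + 4 * suc m                          ≡⟨ regroup c d m ⟩
    (c + 2) + (c + 2) + (d + (m + m)) + (d + (m + m))  ≡⟨ cong₂ (λ x y → x + x + y + y) c+2≡P d+2m≡P ⟩
    P + P + P + P                                      ≡⟨ quadruple P ⟩
    2 * (2 * P)                                        ∎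

census-size : ∀ m → length (Census.L (suc m)) ≡ (2 ^ (suc (suc m) + 1) ∸ 4 * suc (suc m)) + 2
census-size m = begin
  length L                                 ≡⟨ length-L ⟩
  2 ^ suc m + (count nonconstant (suc m) + (count nonmonotone (suc m) + count nonmonotone (suc m)))
    ≡⟨ census-arithmetic (suc m) (2 ^ suc m) _ _ (count-nonconstant m) (count-nonmonotone m) ⟩
  (2 ^ (1 + n) ∸ 4 * n) + 2                ≡⟨ cong (λ k → (2 ^ k ∸ 4 * n) + 2) (+-comm 1 n) ⟩
  (2 ^ (n + 1) ∸ 4 * n) + 2                ∎
  where
  open ≡-Reasoning
  open Census (suc m)
  n = suc (suc m)

extra-short : All (λ π → length π ≤ 5) extra
extra-short = from-yes (All.all? (λ π → length π ≤? 5) extra)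

InA⇒InW : ∀ {n σ} → 6 ≤ n → IsPerm n σ → InA σ → InW σ
InA⇒InW _   _    (inj₁ w)  = w
InA⇒InW 6≤n perm (inj₂ σ∈) = ⊥-elim (<-irrefl refl (≤-trans 6≤n
  (subst (_≤ 5) (↭-range-length 1 _ (Equivalence.to (IsPerm⇔range _ _) perm)) (All.lookup extra-short σ∈))))

mainTheorem6 : ∀ n → 6 ≤ n → CardA n ((2 ^ (n + 1) ∸ 4 * n) + 2)
mainTheorem6 (suc zero)    (s≤s ())
mainTheorem6 (suc (suc m)) 6≤n = L , Unique-L , census-size m , membership
  where
  open Census (suc m)
  membership : ∀ σ → σ ∈ L ⇔ (IsPerm (suc (suc m)) σ × InA σ)
  membership σ = mk⇔
    (λ σ∈ → let σ↭ , w = Equivalence.to (L⇔ σ) σ∈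
            in Equivalence.from (IsPerm⇔range _ σ) σ↭ , inj₁ (Equivalence.from InW⇔ w))
    (λ (perm , a) → Equivalence.from (L⇔ σ)
       (Equivalence.to (IsPerm⇔range _ σ) perm , Equivalence.to InW⇔ (InA⇒InW 6≤n perm a)))
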